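{- (1) If $T$ is a tree, then $p(S_T,|E(T)|)=|V(T)|$. (2) If $U$ is a connected unicyclic graph, then $p(S_U,|E(U)|)=2$.
   Context: All graphs are finite, undirected, without loops or multiple edges. The subdivision graph $S_G$ of a graph $G$ is obtained from $G$ by inserting into each edge $e=\{u,v\}$ of $G$ a new vertex of degree $2$ (also denoted $e$), so that $e$ is replaced by the two edges $\{e,u\}$ and $\{e,v\}$. An $r$-matching of a graph is a set of $r$ pairwise disjoint edges; $p(G,r)$ denotes the number of $r$-matchings of $G$, with $p(G,0)=1$. A unicyclic graph is a connected graph containing exactly one cycle. -}

module Defs where

open import Data.Nat using (ℕ; zero; suc; _+_; _≤_)
open import Data.Fin as Fin using (Fin; _↑ˡ_; _↑ʳ_; _≟_)
open import Data.Bool using (Bool; true; false; _∧_; _∨_; not; if_then_else_)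
open import Data.List using (List; []; _∷_; [_]; _++_; map; concat; length; zip; allFin; lookup)
open import Data.List.Relation.Unary.All using () 
open import Data.List.Membership.Propositional using (_∈_)
open import Data.List.Relation.Unary.All using (All)
open import Data.List.Relation.Unary.Unique.Propositional using (Unique)
open import Data.Product using (_×_; _,_; proj₁; proj₂; Σ)
open import Data.Sum using (_⊎_)
open import Relation.Nullary using (¬_)
open import Relation.Nullary.Decidable using (⌊_⌋)
open import Function.Bundles using (_⇔_)

-- A graph on the vertex set Fin n, given by its list of edges.
-- An edge {u,v} is stored as the ordered pair (u , v) with u < v.
record Graph (n : ℕ) : Set where
  constructor mkGraph
  field
    edges : List (Fin n × Fin n)
open Graph public

Simple : ∀ {n} → Graph n → Set
Simple G = All (λ e → proj₁ e Fin.< proj₂ e) (edges G) × Unique (edges G)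

Adj : ∀ {n} → Graph n → Fin n → Fin n → Set
Adj G u v = ((u , v) ∈ edges G) ⊎ ((v , u) ∈ edges G)

data Walk {n} (G : Graph n) : Fin n → Fin n → Set where
  []  : ∀ {u} → Walk G u u
  _∷_ : ∀ {u v w} → Adj G u v → Walk G v w → Walk G u w

-- Connected graphs are nonempty by convention.
Connected : ∀ {n} → Graph n → Set
Connected {n} G = (1 ≤ n) × (∀ u v → Walk G u v)

cycPairs : ∀ {n} → List (Fin n) → List (Fin n × Fin n)
cycPairs [] = []
cycPairs (x ∷ xs) = zip (x ∷ xs) (xs ++ [ x ])

IsCycle : ∀ {n} → Graph n → List (Fin n) → Set
IsCycle G vs = (3 ≤ length vs) × Unique vs × All (λ p → Adj G (proj₁ p) (proj₂ p)) (cycPairs vs)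

CycEdge : ∀ {n} → List (Fin n) → Fin n → Fin n → Set
CycEdge vs u v = ((u , v) ∈ cycPairs vs) ⊎ ((v , u) ∈ cycPairs vs)

-- Two vertex sequences describe the same cycle (subgraph) iff they have the same edge set.
SameCycle : ∀ {n} → List (Fin n) → List (Fin n) → Set
SameCycle vs ws = ∀ u v → CycEdge vs u v ⇔ CycEdge ws u v

Acyclic : ∀ {n} → Graph n → Set
Acyclic G = ∀ vs → ¬ IsCycle G vs

IsTree : ∀ {n} → Graph n → Set
IsTree G = Connected G × Acyclic G

Unicyclic : ∀ {n} → Graph n → Set
Unicyclic G = Connected G × Σ (List _) (λ vs → IsCycle G vs × (∀ ws → IsCycle G ws → SameCycle vs ws))

-- Subdivision graph S_G: vertices Fin (n + m) (m = |E(G)|), old vertex u ↦ u ↑ˡ m,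
-- the i-th edge e_i = {u,v} ↦ new vertex n ↑ʳ i, adjacent to u and v.
subdivision : ∀ {n} (G : Graph n) → Graph (n + length (edges G))
subdivision {n} G = mkGraph (concat (map f (allFin m)))
  where
    m = length (edges G)
    f : Fin m → List (Fin (n + m) × Fin (n + m))
    f i = ((proj₁ (lookup (edges G) i)) ↑ˡ m , n ↑ʳ i)
        ∷ ((proj₂ (lookup (edges G) i)) ↑ˡ m , n ↑ʳ i) ∷ []

-- All sub-lists (subsets, by position) of a list.
sublists : ∀ {A : Set} → List A → List (List A)
sublists [] = [] ∷ []
sublists (x ∷ xs) = map (x ∷_) (sublists xs) ++ sublists xs

_==_ : ∀ {n} → Fin n → Fin n → Bool
a == b = ⌊ a ≟ b ⌋

disjointᵇ : ∀ {n} → Fin n × Fin n → Fin n × Fin n → Bool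
disjointᵇ (a , b) (c , d) = not ((a == c) ∨ (a == d) ∨ (b == c) ∨ (b == d))

allᵇ : ∀ {A : Set} → (A → Bool) → List A → Bool
allᵇ p [] = true
allᵇ p (x ∷ xs) = p x ∧ allᵇ p xs

pairwiseDisjointᵇ : ∀ {n} → List (Fin n × Fin n) → Bool
pairwiseDisjointᵇ [] = true
pairwiseDisjointᵇ (e ∷ es) = allᵇ (disjointᵇ e) es ∧ pairwiseDisjointᵇ es

ℕ== : ℕ → ℕ → Bool
ℕ== zero zero = true
ℕ== (suc a) (suc b) = ℕ== a b
ℕ== _ _ = false

countᵇ : ∀ {A : Set} → (A → Bool) → List A → ℕ
countᵇ p [] = 0
countᵇ p (x ∷ xs) = if p x then suc (countᵇ p xs) else countᵇ p xs

matchings : ∀ {n} → Graph n → ℕ → ℕ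
matchings G r = countᵇ (λ s → ℕ== (length s) r ∧ pairwiseDisjointᵇ s) (sublists (edges G))

-- A set of |E(G)| disjoint edges of S_G covers every subdivision vertex, so it amounts to
-- choosing for every edge of G one of its two endpoints, all choices distinct.  Add the
-- edges one at a time, keeping track of the connected components and of their cycle rank
-- (edges − vertices + 1).  The number of such choices avoiding a set A of vertices then
-- factors over the components.  A component of rank k with s vertices, c of them in A,
-- contributes for k = 0 the factor s, 1 or 0 according as c = 0, 1 or ≥ 2 (the one vertex
-- left unchosen is arbitrary, or must be the one in A), for k = 1 the factor 2 or 0
-- according as c = 0 or ≥ 1 (the two orientations of its cycle), and 0 for k ≥ 2.  A
-- connected graph is a single component, of rank 0 if it is a tree and 1 if it is unicyclic.

module Submission where

open import Defs
open import Data.Nat using (ℕ; zero; suc; _+_; _*_; _≤_; _<_; z≤n; s≤s)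
import Data.Nat.Properties as ℕ
open import Data.Nat.ListAction using (sum; product)
import Data.Nat.ListAction.Properties as ℕ
open import Data.Bool using (Bool; true; false; _∧_; _∨_; not; if_then_else_)
import Data.Bool.Properties as Bool
open import Data.List using (List; []; _∷_; [_]; _++_; map; concat; zip; allFin; lookup; length)
import Data.List.Properties as List
open import Data.List.Membership.Propositional using (_∈_; _∉_)
import Data.List.Membership.Propositional.Properties as ∈
open import Data.List.Membership.DecPropositional using () renaming (_∈?_ to member?)
open import Data.List.Relation.Unary.Any using (here; there)
open import Data.List.Relation.Unary.All using (All; []; _∷_)
import Data.List.Relation.Unary.All as All
import Data.List.Relation.Unary.All.Properties as All
open import Data.List.Relation.Unary.AllPairs using (AllPairs)
import Data.List.Relation.Unary.AllPairs as AllPairs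
import Data.List.Relation.Unary.AllPairs.Properties as AllPairs
open import Data.List.Relation.Unary.Unique.Propositional using (Unique; []; _∷_)
import Data.List.Relation.Unary.Unique.Propositional.Properties as Unique
open import Data.List.Relation.Binary.Permutation.Propositional
  using (_↭_; ↭-refl; ↭-sym; ↭-trans; ↭-reflexive; prep; swap; ↭⇒↭ₛ)
import Data.List.Relation.Binary.Permutation.Propositional as ↭
import Data.List.Relation.Binary.Permutation.Propositional.Properties as ↭
import Data.List.Relation.Binary.Permutation.Setoid.Properties as ↭ₛ
open import Data.Fin as Fin using (Fin; _↑ˡ_; _↑ʳ_)
import Data.Fin.Properties as Fin
open import Data.Product as × using (_×_; _,_; proj₁; proj₂; Σ; ∃)
open import Data.Product.Properties using (≡-dec)
open import Data.Sum using (_⊎_; inj₁; inj₂)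
open import Data.Empty using (⊥; ⊥-elim)
open import Relation.Nullary using (¬_; Dec; yes; no)
open import Relation.Binary.PropositionalEquality
  using (_≡_; _≢_; refl; sym; trans; cong; cong₂; subst; setoid; module ≡-Reasoning)
open import Function using (_∘_; id)
open import Function.Bundles using (Equivalence)
open import Algebra.Bundles using (CommutativeMonoid)
open import Algebra.Properties.CommutativeSemigroup (CommutativeMonoid.commutativeSemigroup Bool.∧-commutativeMonoid)
  using () renaming (interchange to ∧-interchange)

==-refl : ∀ {n} (x : Fin n) → (x == x) ≡ true
==-refl x with x Fin.≟ x
... | yes _ = refl
... | no x≢x = ⊥-elim (x≢x refl)

≢⇒==-false : ∀ {n} {x y : Fin n} → x ≢ y → (x == y) ≡ false
≢⇒==-false {x = x} {y} x≢y with x Fin.≟ y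
... | yes x≡y = ⊥-elim (x≢y x≡y)
... | no _ = refl

==-sym : ∀ {n} (x y : Fin n) → (x == y) ≡ (y == x)
==-sym x y with x Fin.≟ y
... | yes refl = sym (==-refl x)
... | no x≢y = sym (≢⇒==-false (x≢y ∘ sym))

==-injective : ∀ {a b} (f : Fin a → Fin b) → (∀ {x y} → f x ≡ f y → x ≡ y) →
               ∀ x y → (f x == f y) ≡ (x == y)
==-injective f f-inj x y with x Fin.≟ y
... | yes refl = ==-refl (f x)
... | no x≢y = ≢⇒==-false (x≢y ∘ f-inj)

_∈ᵇ_ : ∀ {n} → Fin n → List (Fin n) → Bool
x ∈ᵇ [] = false
x ∈ᵇ (a ∷ A) = (x == a) ∨ (x ∈ᵇ A)

∈ᵇ⇒∈ : ∀ {n} {x : Fin n} A → (x ∈ᵇ A) ≡ true → x ∈ A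
∈ᵇ⇒∈ {x = x} (a ∷ A) h with x Fin.≟ a
... | yes x≡a = here x≡a
... | no _ = there (∈ᵇ⇒∈ A h)

∈⇒∈ᵇ : ∀ {n} {x : Fin n} {A} → x ∈ A → (x ∈ᵇ A) ≡ true
∈⇒∈ᵇ {x = x} (here refl) rewrite ==-refl x = refl
∈⇒∈ᵇ {x = x} {a ∷ A} (there x∈A) rewrite ∈⇒∈ᵇ x∈A = Bool.∨-zeroʳ (x == a)

∉⇒∈ᵇ-false : ∀ {n} {x : Fin n} {A} → x ∉ A → (x ∈ᵇ A) ≡ false
∉⇒∈ᵇ-false {x = x} {A} x∉A with x ∈ᵇ A in eq
... | true = ⊥-elim (x∉A (∈ᵇ⇒∈ A eq))
... | false = refl

∈ᵇ-false⇒∉ : ∀ {n} {x : Fin n} {A} → (x ∈ᵇ A) ≡ false → x ∉ A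
∈ᵇ-false⇒∉ h x∈A with () ← trans (sym (∈⇒∈ᵇ x∈A)) h

∈ᵇ-map : ∀ {a b} (f : Fin a → Fin b) → (∀ {x y} → f x ≡ f y → x ≡ y) →
         ∀ x A → (f x ∈ᵇ map f A) ≡ (x ∈ᵇ A)
∈ᵇ-map f f-inj x [] = refl
∈ᵇ-map f f-inj x (a ∷ A) = cong₂ _∨_ (==-injective f f-inj x a) (∈ᵇ-map f f-inj x A)

countᵇ-++ : ∀ {A : Set} (p : A → Bool) xs ys → countᵇ p (xs ++ ys) ≡ countᵇ p xs + countᵇ p ys
countᵇ-++ p [] ys = refl
countᵇ-++ p (x ∷ xs) ys with p x
... | true = cong suc (countᵇ-++ p xs ys)
... | false = countᵇ-++ p xs ys

countᵇ-map : ∀ {A B : Set} (p : B → Bool) (f : A → B) xs → countᵇ p (map f xs) ≡ countᵇ (p ∘ f) xs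
countᵇ-map p f [] = refl
countᵇ-map p f (x ∷ xs) with p (f x)
... | true = cong suc (countᵇ-map p f xs)
... | false = countᵇ-map p f xs

countᵇ-cong : ∀ {A : Set} {p q : A → Bool} xs → (∀ {x} → x ∈ xs → p x ≡ q x) →
              countᵇ p xs ≡ countᵇ q xs
countᵇ-cong [] eq = refl
countᵇ-cong {p = p} {q} (x ∷ xs) eq with p x | q x | eq (here refl)
... | true | true | _ = cong suc (countᵇ-cong xs (eq ∘ there))
... | false | false | _ = countᵇ-cong xs (eq ∘ there)

countᵇ-none : ∀ {A : Set} (p : A → Bool) xs → (∀ {x} → x ∈ xs → p x ≡ false) → countᵇ p xs ≡ 0
countᵇ-none p [] none = refl
countᵇ-none p (x ∷ xs) none with p x | none (here refl)
... | false | _ = countᵇ-none p xs (none ∘ there)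

countᵇ-guard : ∀ {A : Set} (b : Bool) (p : A → Bool) xs →
               countᵇ (λ x → not b ∧ p x) xs ≡ (if b then 0 else countᵇ p xs)
countᵇ-guard true p [] = refl
countᵇ-guard true p (x ∷ xs) = countᵇ-guard true p xs
countᵇ-guard false p xs = refl

countᵇ-sublists-∷ : ∀ {A : Set} (p : List A → Bool) x xs →
                    countᵇ p (sublists (x ∷ xs)) ≡ countᵇ (p ∘ (x ∷_)) (sublists xs) + countᵇ p (sublists xs)
countᵇ-sublists-∷ p x xs = trans (countᵇ-++ p (map (x ∷_) (sublists xs)) (sublists xs))
                                  (cong (_+ countᵇ p (sublists xs)) (countᵇ-map p (x ∷_) (sublists xs)))

sublists-⊆ : ∀ {A : Set} (xs : List A) {ys} → ys ∈ sublists xs → All (_∈ xs) ys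
sublists-⊆ [] (here refl) = []
sublists-⊆ (x ∷ xs) ys∈ with ∈.∈-++⁻ (map (x ∷_) (sublists xs)) ys∈
... | inj₂ ys∈′ = All.map there (sublists-⊆ xs ys∈′)
... | inj₁ x∷ys∈ with ∈.∈-map⁻ (x ∷_) x∷ys∈
... | ys′ , ys′∈ , refl = here refl ∷ All.map there (sublists-⊆ xs ys′∈)

not-∨ : ∀ a b → not (a ∨ b) ≡ not a ∧ not b
not-∨ true b = refl
not-∨ false b = refl


allᵇ-cong : ∀ {A : Set} {f g : A → Bool} xs → (∀ {x} → x ∈ xs → f x ≡ g x) → allᵇ f xs ≡ allᵇ g xs
allᵇ-cong [] eq = refl
allᵇ-cong (x ∷ xs) eq = cong₂ _∧_ (eq (here refl)) (allᵇ-cong xs (eq ∘ there))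

allᵇ-∧ : ∀ {A : Set} (f g : A → Bool) xs → allᵇ (λ x → f x ∧ g x) xs ≡ allᵇ f xs ∧ allᵇ g xs
allᵇ-∧ f g [] = refl
allᵇ-∧ f g (x ∷ xs) =
  trans (cong ((f x ∧ g x) ∧_) (allᵇ-∧ f g xs)) (∧-interchange (f x) (g x) (allᵇ f xs) (allᵇ g xs))

Unique-++⁻ˡ : ∀ {A : Set} (xs : List A) {ys} → Unique (xs ++ ys) → Unique xs
Unique-++⁻ˡ [] _ = []
Unique-++⁻ˡ (x ∷ xs) (x∉ ∷ u) = All.++⁻ˡ xs x∉ ∷ Unique-++⁻ˡ xs u

Unique-++⁻ʳ : ∀ {A : Set} (xs : List A) {ys} → Unique (xs ++ ys) → Unique ys
Unique-++⁻ʳ [] u = u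
Unique-++⁻ʳ (x ∷ xs) (_ ∷ u) = Unique-++⁻ʳ xs u

Unique-++⇒disjoint : ∀ {A : Set} (xs : List A) {ys x} → Unique (xs ++ ys) → x ∈ xs → x ∉ ys
Unique-++⇒disjoint (x ∷ xs) (x∉ ∷ _) (here refl) x∈ys = All.lookup x∉ (∈.∈-++⁺ʳ xs x∈ys) refl
Unique-++⇒disjoint (_ ∷ xs) (_ ∷ u) (there x∈xs) = Unique-++⇒disjoint xs u x∈xs

Unique-resp-↭ : ∀ {A : Set} {xs ys : List A} → xs ↭ ys → Unique xs → Unique ys
Unique-resp-↭ {A} p = ↭ₛ.Unique-resp-↭ (setoid A) (↭⇒↭ₛ p)

∈-zip⁻ˡ : ∀ {A : Set} {a b : A} xs ys → (a , b) ∈ zip xs ys → a ∈ xs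
∈-zip⁻ˡ (x ∷ xs) (y ∷ ys) (here refl) = here refl
∈-zip⁻ˡ (x ∷ xs) (y ∷ ys) (there ab∈) = there (∈-zip⁻ˡ xs ys ab∈)

∈-zip⁻ʳ : ∀ {A : Set} {a b : A} xs ys → (a , b) ∈ zip xs ys → b ∈ ys
∈-zip⁻ʳ (x ∷ xs) (y ∷ ys) (here refl) = here refl
∈-zip⁻ʳ (x ∷ xs) (y ∷ ys) (there ab∈) = there (∈-zip⁻ʳ xs ys ab∈)

Unique-∷ʳ : ∀ {A : Set} {x : A} xs → Unique xs → x ∉ xs → Unique (xs ++ [ x ])
Unique-∷ʳ xs uniq x∉ = Unique.++⁺ uniq ([] ∷ []) λ { (x∈ , here refl) → x∉ x∈ }

-- choices es A: the number of ways to choose an endpoint of every edge of es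
-- so that the chosen vertices are distinct and lie outside A.
choices : ∀ {n} → List (Fin n × Fin n) → List (Fin n) → ℕ
choices [] A = 1
choices ((u , v) ∷ es) A =
  (if u ∈ᵇ A then 0 else choices es (u ∷ A)) + (if v ∈ᵇ A then 0 else choices es (v ∷ A))

choices-map : ∀ {a b} (f : Fin a → Fin b) → (∀ {x y} → f x ≡ f y → x ≡ y) →
              ∀ es A → choices (map (×.map f f) es) (map f A) ≡ choices es A
choices-map f f-inj [] A = refl
choices-map f f-inj ((u , v) ∷ es) A
  rewrite ∈ᵇ-map f f-inj u A | ∈ᵇ-map f f-inj v A
        | choices-map f f-inj es (u ∷ A) | choices-map f f-inj es (v ∷ A) = refl

-- Matchings of a subdivision

-- (x , y , t) is the edge {x , y} subdivided by the vertex t.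
SubdividedEdge : ℕ → Set
SubdividedEdge N = Fin N × Fin N × Fin N

endpoints : ∀ {N} → SubdividedEdge N → Fin N × Fin N
endpoints (x , y , t) = x , y

halvesOf : ∀ {N} → SubdividedEdge N → List (Fin N × Fin N)
halvesOf (x , y , t) = (x , t) ∷ (y , t) ∷ []

halves : ∀ {N} → List (SubdividedEdge N) → List (Fin N × Fin N)
halves E = concat (map halvesOf E)

Apart : ∀ {N} → SubdividedEdge N → SubdividedEdge N → Set
Apart (x , y , t) (x′ , y′ , t′) = t′ ≢ t × x′ ≢ t × y′ ≢ t × t′ ≢ x × t′ ≢ y

HalfApart : ∀ {N} → Fin N × Fin N → Fin N × Fin N → Set
HalfApart (x , t) (a , b) = b ≢ x × a ≢ t × b ≢ t

halves-apart : ∀ {N} {x y t : Fin N} {E} → All (Apart (x , y , t)) E →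
               ∀ {p} → p ∈ halves E → HalfApart (x , t) p × HalfApart (y , t) p
halves-apart ((t′≢t , x′≢t , _ , t′≢x , t′≢y) ∷ _) (here refl) =
  (t′≢x , x′≢t , t′≢t) , (t′≢y , x′≢t , t′≢t)
halves-apart ((t′≢t , _ , y′≢t , t′≢x , t′≢y) ∷ _) (there (here refl)) =
  (t′≢x , y′≢t , t′≢t) , (t′≢y , y′≢t , t′≢t)
halves-apart (_ ∷ apart) (there (there p∈)) = halves-apart apart p∈

avoids : ∀ {N} → List (Fin N) → Fin N × Fin N → Bool
avoids A (a , _) = not (a ∈ᵇ A)

isMatchingAvoiding : ∀ {N} → List (Fin N) → ℕ → List (Fin N × Fin N) → Bool
isMatchingAvoiding A r s = ℕ== (length s) r ∧ (pairwiseDisjointᵇ s ∧ allᵇ (avoids A) s)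

matchingsAvoiding : ∀ {N} → List (SubdividedEdge N) → List (Fin N) → ℕ → ℕ
matchingsAvoiding E A r = countᵇ (isMatchingAvoiding A r) (sublists (halves E))

module _ {N : ℕ} where

  allᵇ-avoids-[] : (s : List (Fin N × Fin N)) → allᵇ (avoids []) s ≡ true
  allᵇ-avoids-[] [] = refl
  allᵇ-avoids-[] (_ ∷ s) = allᵇ-avoids-[] s

  disjointᵇ-apart : {x t : Fin N} (p : Fin N × Fin N) → HalfApart (x , t) p →
                    disjointᵇ (x , t) p ≡ not (proj₁ p == x)
  disjointᵇ-apart {x} {t} (a , b) (b≢x , a≢t , b≢t)
    rewrite ≢⇒==-false (b≢x ∘ sym) | ≢⇒==-false (a≢t ∘ sym) | ≢⇒==-false (b≢t ∘ sym)
          | Bool.∨-identityʳ (x == a) | ==-sym x a = refl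

  isMatchingAvoiding-∷ : ∀ (x t : Fin N) A r s → All (HalfApart (x , t)) s →
                         isMatchingAvoiding A (suc r) ((x , t) ∷ s)
                           ≡ not (x ∈ᵇ A) ∧ isMatchingAvoiding (x ∷ A) r s
  isMatchingAvoiding-∷ x t A r s apart
    rewrite allᵇ-cong {f = disjointᵇ (x , t)} s (λ {p} p∈ → disjointᵇ-apart p (All.lookup apart p∈))
          | allᵇ-cong {f = avoids (x ∷ A)} s (λ {p} _ → not-∨ (proj₁ p == x) (proj₁ p ∈ᵇ A))
          | allᵇ-∧ (λ p → not (proj₁ p == x)) (avoids A) s
    = ∧-shuffle (ℕ== (length s) r) (allᵇ (λ p → not (proj₁ p == x)) s) (pairwiseDisjointᵇ s)
                (not (x ∈ᵇ A)) (allᵇ (avoids A) s)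
    where
      ∧-shuffle : ∀ a b c d e → a ∧ ((b ∧ c) ∧ (d ∧ e)) ≡ d ∧ (a ∧ (c ∧ (b ∧ e)))
      ∧-shuffle false b c d e = sym (Bool.∧-zeroʳ d)
      ∧-shuffle true b c false e = Bool.∧-zeroʳ (b ∧ c)
      ∧-shuffle true false c true e = sym (Bool.∧-zeroʳ c)
      ∧-shuffle true true c true e = refl

  isMatchingAvoiding-shared : ∀ (x y t : Fin N) A r s → isMatchingAvoiding A r ((x , t) ∷ (y , t) ∷ s) ≡ false
  isMatchingAvoiding-shared x y t A r s
    rewrite ==-refl t | Bool.∨-zeroʳ (t == y) | Bool.∨-zeroʳ (x == t) | Bool.∨-zeroʳ (x == y)
    = Bool.∧-zeroʳ (ℕ== (length ((x , t) ∷ (y , t) ∷ s)) r)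

  matchingsAvoiding-∷ : ∀ (x y t : Fin N) E A r → All (Apart (x , y , t)) E →
    matchingsAvoiding ((x , y , t) ∷ E) A (suc r) ≡
    (if x ∈ᵇ A then 0 else matchingsAvoiding E (x ∷ A) r)
      + (if y ∈ᵇ A then 0 else matchingsAvoiding E (y ∷ A) r)
      + matchingsAvoiding E A (suc r)
  matchingsAvoiding-∷ x y t E A r apart = begin
      countᵇ P (sublists ((x , t) ∷ (y , t) ∷ halves E))
    ≡⟨ countᵇ-sublists-∷ P (x , t) ((y , t) ∷ halves E) ⟩
      countᵇ (P ∘ ((x , t) ∷_)) (sublists ((y , t) ∷ halves E)) + countᵇ P (sublists ((y , t) ∷ halves E))
    ≡⟨ cong₂ _+_ (countᵇ-sublists-∷ (P ∘ ((x , t) ∷_)) (y , t) (halves E))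
                 (countᵇ-sublists-∷ P (y , t) (halves E)) ⟩
      (countᵇ (λ s → P ((x , t) ∷ (y , t) ∷ s)) S + countᵇ (P ∘ ((x , t) ∷_)) S)
        + (countᵇ (P ∘ ((y , t) ∷_)) S + countᵇ P S)
    ≡⟨ cong (λ z → (z + countᵇ (P ∘ ((x , t) ∷_)) S) + (countᵇ (P ∘ ((y , t) ∷_)) S + countᵇ P S))
            (countᵇ-none _ S (λ {s} _ → isMatchingAvoiding-shared x y t A (suc r) s)) ⟩
      countᵇ (P ∘ ((x , t) ∷_)) S + (countᵇ (P ∘ ((y , t) ∷_)) S + countᵇ P S)
    ≡⟨ sym (ℕ.+-assoc (countᵇ (P ∘ ((x , t) ∷_)) S) _ _) ⟩
      countᵇ (P ∘ ((x , t) ∷_)) S + countᵇ (P ∘ ((y , t) ∷_)) S + countᵇ P S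
    ≡⟨ cong (_+ countᵇ P S) (cong₂ _+_ (choose x proj₁) (choose y proj₂)) ⟩
      (if x ∈ᵇ A then 0 else matchingsAvoiding E (x ∷ A) r)
        + (if y ∈ᵇ A then 0 else matchingsAvoiding E (y ∷ A) r)
        + matchingsAvoiding E A (suc r)
    ∎
    where
      open ≡-Reasoning
      S = sublists (halves E)
      P = isMatchingAvoiding A (suc r)
      choose : ∀ z → (∀ {p} → HalfApart (x , t) p × HalfApart (y , t) p → HalfApart (z , t) p) →
               countᵇ (P ∘ ((z , t) ∷_)) S ≡ (if z ∈ᵇ A then 0 else matchingsAvoiding E (z ∷ A) r)
      choose z which = trans
        (countᵇ-cong S (λ {s} s∈ → isMatchingAvoiding-∷ z t A r s
          (All.map (λ p∈ → which (halves-apart apart p∈)) (sublists-⊆ (halves E) s∈))))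
        (countᵇ-guard (z ∈ᵇ A) (isMatchingAvoiding (z ∷ A) r) S)

  matchingsAvoiding-tooLarge : ∀ (E : List (SubdividedEdge N)) A r → AllPairs Apart E → length E < r →
                               matchingsAvoiding E A r ≡ 0
  matchingsAvoiding-tooLarge [] A (suc r) _ _ = refl
  matchingsAvoiding-tooLarge ((x , y , t) ∷ E) A (suc r) (apart ∷ apart*) (s≤s |E|<r)
    rewrite matchingsAvoiding-∷ x y t E A r apart
          | matchingsAvoiding-tooLarge E (x ∷ A) r apart* |E|<r
          | matchingsAvoiding-tooLarge E (y ∷ A) r apart* |E|<r
          | matchingsAvoiding-tooLarge E A (suc r) apart* (ℕ.m≤n⇒m≤1+n |E|<r)
          | Bool.if-eta (x ∈ᵇ A) {0} | Bool.if-eta (y ∈ᵇ A) {0} = refl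

  matchingsAvoiding-perfect : ∀ (E : List (SubdividedEdge N)) A → AllPairs Apart E →
                              matchingsAvoiding E A (length E) ≡ choices (map endpoints E) A
  matchingsAvoiding-perfect [] A _ = refl
  matchingsAvoiding-perfect ((x , y , t) ∷ E) A (apart ∷ apart*)
    rewrite matchingsAvoiding-∷ x y t E A (length E) apart
          | matchingsAvoiding-tooLarge E A (suc (length E)) apart* ℕ.≤-refl
          | matchingsAvoiding-perfect E (x ∷ A) apart* | matchingsAvoiding-perfect E (y ∷ A) apart*
    = ℕ.+-identityʳ _

↑ˡ≢↑ʳ : ∀ {n m} (x : Fin n) (i : Fin m) → x ↑ˡ m ≢ n ↑ʳ i
↑ˡ≢↑ʳ {suc n} Fin.zero i ()
↑ˡ≢↑ʳ {suc n} (Fin.suc x) i eq = ↑ˡ≢↑ʳ x i (Fin.suc-injective eq)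

module _ {n : ℕ} (G : Graph n) where

  private
    m : ℕ
    m = length (edges G)

  subdividedEdge : Fin m → SubdividedEdge (n + m)
  subdividedEdge i = proj₁ (lookup (edges G) i) ↑ˡ m , proj₂ (lookup (edges G) i) ↑ˡ m , n ↑ʳ i

  subdividedEdges : List (SubdividedEdge (n + m))
  subdividedEdges = map subdividedEdge (allFin m)

  halves-subdividedEdges : halves subdividedEdges ≡ edges (subdivision G)
  halves-subdividedEdges = cong concat (sym (List.map-∘ (allFin m)))

  subdividedEdges-apart : AllPairs Apart subdividedEdges
  subdividedEdges-apart = AllPairs.map⁺ (AllPairs.map apart (Unique.allFin⁺ m))
    where
      apart : ∀ {i j} → i ≢ j → Apart (subdividedEdge i) (subdividedEdge j)
      apart {i} {j} i≢j = i≢j ∘ sym ∘ Fin.↑ʳ-injective n j i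
                        , ↑ˡ≢↑ʳ _ i , ↑ˡ≢↑ʳ _ i , ↑ˡ≢↑ʳ _ j ∘ sym , ↑ˡ≢↑ʳ _ j ∘ sym

  length-subdividedEdges : length subdividedEdges ≡ m
  length-subdividedEdges = trans (List.length-map subdividedEdge (allFin m)) (List.length-tabulate id)

  endpoints-subdividedEdges : map endpoints subdividedEdges ≡ map (×.map (_↑ˡ m) (_↑ˡ m)) (edges G)
  endpoints-subdividedEdges = begin
      map endpoints (map subdividedEdge (allFin m))
    ≡⟨ List.map-∘ (allFin m) ⟨
      map (×.map (_↑ˡ m) (_↑ˡ m) ∘ lookup (edges G)) (allFin m)
    ≡⟨ List.map-∘ (allFin m) ⟩
      map (×.map (_↑ˡ m) (_↑ˡ m)) (map (lookup (edges G)) (allFin m))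
    ≡⟨ cong (map (×.map (_↑ˡ m) (_↑ˡ m)))
            (trans (List.map-tabulate id (lookup (edges G))) (List.tabulate-lookup (edges G))) ⟩
      map (×.map (_↑ˡ m) (_↑ˡ m)) (edges G)
    ∎
    where open ≡-Reasoning

  matchings-subdivision : matchings (subdivision G) m ≡ choices (edges G) []
  matchings-subdivision = begin
      countᵇ (λ s → ℕ== (length s) m ∧ pairwiseDisjointᵇ s) (sublists (edges (subdivision G)))
    ≡⟨ cong (λ H → countᵇ (λ s → ℕ== (length s) m ∧ pairwiseDisjointᵇ s) (sublists H))
            halves-subdividedEdges ⟨
      countᵇ (λ s → ℕ== (length s) m ∧ pairwiseDisjointᵇ s) (sublists (halves subdividedEdges))
    ≡⟨ countᵇ-cong (sublists (halves subdividedEdges)) (λ {s} _ → cong (λ b → ℕ== (length s) m ∧ b)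
         (sym (trans (cong (pairwiseDisjointᵇ s ∧_) (allᵇ-avoids-[] s)) (Bool.∧-identityʳ _)))) ⟩
      matchingsAvoiding subdividedEdges [] m
    ≡⟨ cong (matchingsAvoiding subdividedEdges []) length-subdividedEdges ⟨
      matchingsAvoiding subdividedEdges [] (length subdividedEdges)
    ≡⟨ matchingsAvoiding-perfect subdividedEdges [] subdividedEdges-apart ⟩
      choices (map endpoints subdividedEdges) []
    ≡⟨ cong (λ es → choices es []) endpoints-subdividedEdges ⟩
      choices (map (×.map (_↑ˡ m) (_↑ˡ m)) (edges G)) []
    ≡⟨ choices-map (_↑ˡ m) (Fin.↑ˡ-injective m _ _) (edges G) [] ⟩
      choices (edges G) []
    ∎
    where open ≡-Reasoning

-- weight k s c is the value of choices for a connected graph with s vertices and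
-- s − 1 + k edges when c of its vertices are excluded.
rootChoices : ℕ → ℕ → ℕ
rootChoices zero s = s
rootChoices (suc zero) s = 2
rootChoices (suc (suc k)) s = 0

treeIndicator : ℕ → ℕ
treeIndicator zero = 1
treeIndicator (suc k) = 0

weight : ℕ → ℕ → ℕ → ℕ
weight k s zero = rootChoices k s
weight k s (suc zero) = treeIndicator k
weight k s (suc (suc c)) = 0

treeIndicator-+ : ∀ k l → treeIndicator k * treeIndicator l ≡ treeIndicator (k + l)
treeIndicator-+ zero l = ℕ.+-identityʳ (treeIndicator l)
treeIndicator-+ (suc k) l = refl

rootChoices-+ : ∀ k l s t →
  treeIndicator k * rootChoices l t + rootChoices k s * treeIndicator l ≡ rootChoices (k + l) (s + t)
rootChoices-+ zero zero s t
  rewrite ℕ.*-identityˡ t | ℕ.*-identityʳ s = ℕ.+-comm t s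
rootChoices-+ zero (suc zero) s t = cong (2 +_) (ℕ.*-zeroʳ s)
rootChoices-+ zero (suc (suc l)) s t = ℕ.*-zeroʳ s
rootChoices-+ (suc zero) zero s t = refl
rootChoices-+ (suc zero) (suc l) s t = refl
rootChoices-+ (suc (suc k)) l s t = refl

weight-close : ∀ k s c → weight k s (suc c) + weight k s (suc c) ≡ weight (suc k) s c
weight-close zero s zero = refl
weight-close (suc k) s zero = refl
weight-close k s (suc zero) = refl
weight-close k s (suc (suc c)) = refl

weight-join : ∀ k l s t c d →
  weight k s (suc c) * weight l t d + weight k s c * weight l t (suc d) ≡ weight (k + l) (s + t) (c + d)
weight-join k l s t zero zero = rootChoices-+ k l s t
weight-join k l s t zero (suc zero) =
  trans (cong (treeIndicator k * treeIndicator l +_) (ℕ.*-zeroʳ (rootChoices k s)))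
        (trans (ℕ.+-identityʳ _) (treeIndicator-+ k l))
weight-join k l s t zero (suc (suc d)) = cong₂ _+_ (ℕ.*-zeroʳ (treeIndicator k)) (ℕ.*-zeroʳ (rootChoices k s))
weight-join k l s t (suc zero) zero = treeIndicator-+ k l
weight-join k l s t (suc zero) (suc d) = ℕ.*-zeroʳ (treeIndicator k)
weight-join k l s t (suc (suc c)) d = refl

guard-* : ∀ b x y → (if b then 0 else x * y) ≡ x * (if b then 0 else y)
guard-* true x y = sym (ℕ.*-zeroʳ x)
guard-* false x y = refl

countIn : ∀ {n} → List (Fin n) → List (Fin n) → ℕ
countIn A = countᵇ (_∈ᵇ A)

countIn-[] : ∀ {n} (B : List (Fin n)) → countIn [] B ≡ 0
countIn-[] [] = refl
countIn-[] (_ ∷ B) = countIn-[] B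

countIn-∷-∉ : ∀ {n} {x : Fin n} A B → x ∉ B → countIn (x ∷ A) B ≡ countIn A B
countIn-∷-∉ A [] x∉B = refl
countIn-∷-∉ {x = x} A (b ∷ B) x∉B
  rewrite ≢⇒==-false {x = b} {x} (x∉B ∘ here ∘ sym) with b ∈ᵇ A
... | true = cong suc (countIn-∷-∉ A B (x∉B ∘ there))
... | false = countIn-∷-∉ A B (x∉B ∘ there)

countIn-∷-∈ : ∀ {n} {x : Fin n} A B → Unique B → x ∈ B → (x ∈ᵇ A) ≡ false →
              countIn (x ∷ A) B ≡ suc (countIn A B)
countIn-∷-∈ {x = x} A (b ∷ B) (x∉B ∷ _) (here refl) x∉A
  rewrite ==-refl x | x∉A = cong suc (countIn-∷-∉ A B (λ x∈B → All.lookup x∉B x∈B refl))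
countIn-∷-∈ {x = x} A (b ∷ B) (b∉B ∷ u) (there x∈B) x∉A
  rewrite ≢⇒==-false {x = b} {x} (All.lookup b∉B x∈B) with b ∈ᵇ A
... | true = cong suc (countIn-∷-∈ A B u x∈B x∉A)
... | false = countIn-∷-∈ A B u x∈B x∉A

countIn-≡0 : ∀ {n} {x : Fin n} A B → countIn A B ≡ 0 → x ∈ B → (x ∈ᵇ A) ≡ false
countIn-≡0 A (b ∷ B) h (here refl) with b ∈ᵇ A
... | false = refl
countIn-≡0 A (b ∷ B) h (there x∈B) with b ∈ᵇ A
... | false = countIn-≡0 A B h x∈B

Adj-there : ∀ {n} {e : Fin n × Fin n} {es p q} → Adj (mkGraph es) p q → Adj (mkGraph (e ∷ es)) p q
Adj-there (inj₁ pq∈) = inj₁ (there pq∈)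
Adj-there (inj₂ qp∈) = inj₂ (there qp∈)

Adj-sym : ∀ {n} {G : Graph n} {p q} → Adj G p q → Adj G q p
Adj-sym (inj₁ pq∈) = inj₂ pq∈
Adj-sym (inj₂ qp∈) = inj₁ qp∈

Adj-∷⁻ : ∀ {n} {u v : Fin n} {es p q} → Adj (mkGraph ((u , v) ∷ es)) p q →
         (p , q) ≡ (u , v) ⊎ (p , q) ≡ (v , u) ⊎ Adj (mkGraph es) p q
Adj-∷⁻ (inj₁ (here refl)) = inj₁ refl
Adj-∷⁻ (inj₂ (here refl)) = inj₂ (inj₁ refl)
Adj-∷⁻ (inj₁ (there pq∈)) = inj₂ (inj₂ (inj₁ pq∈))
Adj-∷⁻ (inj₂ (there qp∈)) = inj₂ (inj₂ (inj₂ qp∈))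

Adj-flip : ∀ {n} {u v : Fin n} {es p q} → Adj (mkGraph ((u , v) ∷ es)) p q → Adj (mkGraph ((v , u) ∷ es)) p q
Adj-flip (inj₁ (here refl)) = inj₂ (here refl)
Adj-flip (inj₂ (here refl)) = inj₁ (here refl)
Adj-flip (inj₁ (there pq∈)) = inj₁ (there pq∈)
Adj-flip (inj₂ (there qp∈)) = inj₂ (there qp∈)

Walk-there : ∀ {n} {e : Fin n × Fin n} {es p q} → Walk (mkGraph es) p q → Walk (mkGraph (e ∷ es)) p q
Walk-there [] = []
Walk-there (a ∷ w) = Adj-there a ∷ Walk-there w

_++ʷ_ : ∀ {n} {G : Graph n} {p q r} → Walk G p q → Walk G q r → Walk G p r
[] ++ʷ w′ = w′
(a ∷ w) ++ʷ w′ = a ∷ (w ++ʷ w′)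

IsCycle-there : ∀ {n} {e : Fin n × Fin n} {es vs} → IsCycle (mkGraph es) vs → IsCycle (mkGraph (e ∷ es)) vs
IsCycle-there (3≤ , uniq , adj) = 3≤ , uniq , All.map Adj-there adj

stops : ∀ {n} {G : Graph n} {p q} → Walk G p q → List (Fin n)
stops [] = []
stops (_∷_ {v = r} _ w) = r ∷ stops w

private
  dropUntil : ∀ {n} {G : Graph n} {x q} p (w : Walk G x q) → p ∈ x ∷ stops w →
              Σ (Walk G p q) (λ w′ → Unique (x ∷ stops w) → Unique (p ∷ stops w′))
  dropUntil p w (here refl) = w , id
  dropUntil p (a ∷ w) (there p∈) = let (w′ , uniq) = dropUntil p w p∈ in w′ , λ { (_ ∷ u) → uniq u }

walk⇒path : ∀ {n} {G : Graph n} {p q} → Walk G p q → Σ (Walk G p q) (λ w → Unique (p ∷ stops w))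
walk⇒path [] = [] , ([] ∷ [])
walk⇒path {p = p} (_∷_ {v = r} a w) with walk⇒path w
... | w′ , uniq with member? Fin._≟_ p (r ∷ stops w′)
...   | yes p∈ = let (w″ , uniq′) = dropUntil p w′ p∈ in w″ , uniq′ uniq
...   | no p∉ = (a ∷ w′) , (All.¬Any⇒All¬ _ p∉ ∷ uniq)

steps : ∀ {A : Set} → A → List A → A → List (A × A)
steps y ys z = zip (y ∷ ys) (ys ++ [ z ])

steps-last : ∀ {n} {G : Graph n} {p q} (w : Walk G p q) z → (q , z) ∈ steps p (stops w) z
steps-last [] z = here refl
steps-last (_ ∷ w) z = there (steps-last w z)

steps-adjacent : ∀ {n} {e : Fin n × Fin n} {es p q} (w : Walk (mkGraph es) p q) z → Adj (mkGraph (e ∷ es)) q z →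
                 All (λ ab → Adj (mkGraph (e ∷ es)) (proj₁ ab) (proj₂ ab)) (steps p (stops w) z)
steps-adjacent [] z a = a ∷ []
steps-adjacent (a′ ∷ w) z a = Adj-there a′ ∷ steps-adjacent w z a

steps-antisym : ∀ {A : Set} {a b : A} y ys z → Unique (y ∷ ys ++ [ z ]) →
                (a , b) ∈ steps y ys z → (b , a) ∈ steps y ys z → ⊥
steps-antisym y [] z ((y≢z ∷ []) ∷ _) (here refl) (here refl) = y≢z refl
steps-antisym y (y′ ∷ ys) z ((y≢y′ ∷ _) ∷ _) (here refl) (here refl) = y≢y′ refl
steps-antisym y (y′ ∷ ys) z (y∉ ∷ _) (here refl) (there ba∈) =
  All.lookup y∉ (there (∈-zip⁻ʳ (y′ ∷ ys) _ ba∈)) refl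
steps-antisym y (y′ ∷ ys) z (y∉ ∷ _) (there ab∈) (here refl) =
  All.lookup y∉ (there (∈-zip⁻ʳ (y′ ∷ ys) _ ab∈)) refl
steps-antisym y (y′ ∷ ys) z (_ ∷ uniq) (there ab∈) (there ba∈) = steps-antisym y′ ys z uniq ab∈ ba∈

cycPairs-antisym : ∀ {n} {a b : Fin n} vs → 3 ≤ length vs → Unique vs →
                   (a , b) ∈ cycPairs vs → (b , a) ∈ cycPairs vs → ⊥
cycPairs-antisym (x ∷ []) (s≤s ())
cycPairs-antisym (x ∷ x₁ ∷ []) (s≤s (s≤s ()))
cycPairs-antisym (x ∷ x₁ ∷ x₂ ∷ xs) _ (x∉ ∷ uniq₁@(x₁∉ ∷ _)) = antisym
  where
    path-uniq : Unique (x₁ ∷ (x₂ ∷ xs) ++ [ x ])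
    path-uniq = Unique-∷ʳ (x₁ ∷ x₂ ∷ xs) uniq₁ (λ x∈ → All.lookup x∉ x∈ refl)
    back : (x₁ , x) ∈ steps x₁ (x₂ ∷ xs) x → ⊥
    back (here eq) = All.lookup x∉ (there (here refl)) (cong proj₂ eq)
    back (there x₁∈) = All.lookup x₁∉ (∈-zip⁻ˡ (x₂ ∷ xs) _ x₁∈) refl
    antisym : ∀ {a b} → (a , b) ∈ cycPairs (x ∷ x₁ ∷ x₂ ∷ xs) →
              (b , a) ∈ cycPairs (x ∷ x₁ ∷ x₂ ∷ xs) → ⊥
    antisym (here refl) (here eq) = All.lookup x∉ (here refl) (cong proj₂ eq)
    antisym (here refl) (there ba∈) = back ba∈
    antisym (there ab∈) (here refl) = back ab∈
    antisym (there ab∈) (there ba∈) = steps-antisym x₁ (x₂ ∷ xs) x path-uniq ab∈ ba∈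

Simple⇒¬Adj : ∀ {n} {u v : Fin n} {es} → Simple (mkGraph ((u , v) ∷ es)) → ¬ Adj (mkGraph es) u v
Simple⇒¬Adj (_ , (uv∉ ∷ _)) (inj₁ uv∈) = All.lookup uv∉ uv∈ refl
Simple⇒¬Adj ((u<v ∷ ordered) , _) (inj₂ vu∈) = ℕ.<-asym u<v (All.lookup ordered vu∈)

Simple-tail : ∀ {n} {e : Fin n × Fin n} {es} → Simple (mkGraph (e ∷ es)) → Simple (mkGraph es)
Simple-tail ((_ ∷ ordered) , (_ ∷ uniq)) = ordered , uniq

closeWalk : ∀ {n} {u v : Fin n} {es} → Simple (mkGraph ((u , v) ∷ es)) → Walk (mkGraph es) u v →
            Σ (List (Fin n)) (λ vs → IsCycle (mkGraph ((u , v) ∷ es)) vs × (v , u) ∈ cycPairs vs)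
closeWalk {n} {u} {v} {es} simple walk = close (proj₁ (walk⇒path walk)) (proj₂ (walk⇒path walk))
  where
    close : (w : Walk (mkGraph es) u v) → Unique (u ∷ stops w) →
            Σ (List (Fin n)) (λ vs → IsCycle (mkGraph ((u , v) ∷ es)) vs × (v , u) ∈ cycPairs vs)
    close [] _ = ⊥-elim (ℕ.<-irrefl refl (All.head (proj₁ simple)))
    close (a ∷ []) _ = ⊥-elim (Simple⇒¬Adj simple a)
    close w@(_ ∷ _ ∷ _) uniq =
      (u ∷ stops w) , (s≤s (s≤s (s≤s z≤n)) , uniq , steps-adjacent w u (inj₂ (here refl))) , steps-last w u

NeverRises : ∀ {A : Set} → (A → Bool) → List (A × A) → Set
NeverRises s L = ∀ {a b} → (a , b) ∈ L → s a ≡ false → s b ≡ false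

neverRises-false : ∀ {A : Set} (s : A → Bool) y ys z → NeverRises s (steps y ys z) → s y ≡ false → s z ≡ false
neverRises-false s y [] z never sy = never (here refl) sy
neverRises-false s y (y′ ∷ ys) z never sy = neverRises-false s y′ ys z (never ∘ there) (never (here refl) sy)

fall⇒ends : ∀ {A : Set} (s : A → Bool) y ys z → NeverRises s (steps y ys z) →
            ∀ {a b} → (a , b) ∈ steps y ys z → s a ≡ true → s b ≡ false → s y ≡ true × s z ≡ false
fall⇒ends s y [] z never (here refl) sa sb = sa , sb
fall⇒ends s y (y′ ∷ ys) z never (here refl) sa sb = sa , neverRises-false s y′ ys z (never ∘ there) sb
fall⇒ends s y (y′ ∷ ys) z never (there ab∈) sa sb with fall⇒ends s y′ ys z (never ∘ there) ab∈ sa sb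
... | sy′ , sz with s y in sy
...   | true = refl , sz
...   | false with () ← trans (sym sy′) (never (here refl) sy)

cycle-noFall : ∀ {n} (s : Fin n → Bool) y ys → NeverRises s (cycPairs (y ∷ ys)) →
               ∀ {a b} → (a , b) ∈ cycPairs (y ∷ ys) → s a ≡ true → s b ≡ false → ⊥
cycle-noFall s y ys never ab∈ sa sb with fall⇒ends s y ys y never ab∈ sa sb
... | sy , sy′ with () ← trans (sym sy) sy′

-- A labelling preserved along the edges of es changes along the new edge (a , b) only,
-- so a cycle can cross it in one direction only if it crosses back.
cycle-noCrossing : ∀ {n es} {a b : Fin n} (t : Fin n → Bool) →
                   (∀ {p q} → Adj (mkGraph es) p q → t p ≡ t q) →
                   t a ≡ true → t b ≡ false → ∀ x xs →
                   All (λ pq → Adj (mkGraph ((a , b) ∷ es)) (proj₁ pq) (proj₂ pq)) (cycPairs (x ∷ xs)) →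
                   (b , a) ∉ cycPairs (x ∷ xs) → (a , b) ∉ cycPairs (x ∷ xs)
cycle-noCrossing t preserved ta tb x xs adj ba∉ ab∈ = cycle-noFall t x xs neverRises ab∈ ta tb
  where
    neverRises : NeverRises t (cycPairs (x ∷ xs))
    neverRises pq∈ tp with Adj-∷⁻ (All.lookup adj pq∈)
    ... | inj₁ refl with () ← trans (sym ta) tp
    ... | inj₂ (inj₁ refl) = ⊥-elim (ba∉ pq∈)
    ... | inj₂ (inj₂ pq-adj) = trans (sym (preserved pq-adj)) tp

-- Components

record Component (n : ℕ) : Set where
  constructor component
  field
    vertices : List (Fin n)
    -- edges minus vertices plus one, i.e. the number of independent cycles
    rank : ℕ
open Component public

module Components (n : ℕ) where

  allVertices : List (Component n) → List (Fin n)
  allVertices S = concat (map vertices S)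

  allVertices-↭ : ∀ {S S′} → S ↭ S′ → allVertices S ↭ allVertices S′
  allVertices-↭ ↭.refl = ↭-refl
  allVertices-↭ (prep c p) = ↭.++⁺ˡ (vertices c) (allVertices-↭ p)
  allVertices-↭ (swap c d p) =
    ↭-trans (↭.++⁺ˡ (vertices c) (↭.++⁺ˡ (vertices d) (allVertices-↭ p)))
            (↭.shifts (vertices c) (vertices d))
  allVertices-↭ (↭.trans p q) = ↭-trans (allVertices-↭ p) (allVertices-↭ q)

  ∈-allVertices : ∀ {x c} S → c ∈ S → x ∈ vertices c → x ∈ allVertices S
  ∈-allVertices (c ∷ S) (here refl) x∈c = ∈.∈-++⁺ˡ x∈c
  ∈-allVertices (c ∷ S) (there c∈S) x∈ = ∈.∈-++⁺ʳ (vertices c) (∈-allVertices S c∈S x∈)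

  NonEmpty : Component n → Set
  NonEmpty c = 0 < length (vertices c)

  IsPartition : List (Component n) → Set
  IsPartition S = (allVertices S ↭ allFin n) × All NonEmpty S

  IsPartition⇒Unique : ∀ {S} → IsPartition S → Unique (allVertices S)
  IsPartition⇒Unique (S↭ , _) = Unique-resp-↭ (↭-sym S↭) (Unique.allFin⁺ n)

  IsPartition⇒covering : ∀ {S} → IsPartition S → ∀ x → x ∈ allVertices S
  IsPartition⇒covering (S↭ , _) x = ↭.∈-resp-↭ (↭-sym S↭) (∈.∈-allFin x)

  -- the component containing x (an empty junk component if there is none) and the others
  extract : Fin n → List (Component n) → Component n × List (Component n)
  extract x [] = component [] 0 , []
  extract x (c ∷ S) = if x ∈ᵇ vertices c then (c , S) else ×.map₂ (c ∷_) (extract x S)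

  extract-spec : ∀ x S → x ∈ allVertices S →
                 x ∈ vertices (proj₁ (extract x S)) × S ↭ proj₁ (extract x S) ∷ proj₂ (extract x S)
  extract-spec x (c ∷ S) x∈ with x ∈ᵇ vertices c in x∈ᵇc
  ... | true = ∈ᵇ⇒∈ (vertices c) x∈ᵇc , ↭-refl
  ... | false with ∈.∈-++⁻ (vertices c) x∈
  ...   | inj₁ x∈c = ⊥-elim (∈ᵇ-false⇒∉ x∈ᵇc x∈c)
  ...   | inj₂ x∈S = let (x∈d , S↭) = extract-spec x S x∈S in
                     x∈d , ↭-trans (prep c S↭) (swap c (proj₁ (extract x S)) ↭-refl)

  closeCycle : Component n → Component n
  closeCycle c = component (vertices c) (suc (rank c))

  merge : Component n → Component n → Component n
  merge c d = component (vertices c ++ vertices d) (rank c + rank d)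

  addEdge : Fin n × Fin n → List (Component n) → List (Component n)
  addEdge (u , v) S =
    let (c , R) = extract u S in
    if v ∈ᵇ vertices c then closeCycle c ∷ R else merge c (proj₁ (extract v R)) ∷ proj₂ (extract v R)

  data AddEdgeView (u v : Fin n) (S : List (Component n)) : Set where
    within : ∀ c R → S ↭ c ∷ R → u ∈ vertices c → v ∈ vertices c →
             addEdge (u , v) S ≡ closeCycle c ∷ R → AddEdgeView u v S
    joining : ∀ c d R → S ↭ c ∷ d ∷ R → u ∈ vertices c → v ∈ vertices d → v ∉ vertices c →
              addEdge (u , v) S ≡ merge c d ∷ R → AddEdgeView u v S

  addEdgeView : ∀ {S} → IsPartition S → ∀ u v → AddEdgeView u v S
  addEdgeView {S} P u v with extract-spec u S (IsPartition⇒covering P u)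
  ... | u∈c , S↭cR with v ∈ᵇ vertices (proj₁ (extract u S)) in v∈ᵇc
  ... | true = within c R S↭cR u∈c (∈ᵇ⇒∈ _ v∈ᵇc) (Bool.if-cong v∈ᵇc)
    where
      c = proj₁ (extract u S)
      R = proj₂ (extract u S)
  ... | false =
    joining c d R′ (↭-trans S↭cR (prep c R↭dR′)) u∈c v∈d (∈ᵇ-false⇒∉ v∈ᵇc) (Bool.if-cong v∈ᵇc)
    where
      c = proj₁ (extract u S)
      R = proj₂ (extract u S)
      v∈R : v ∈ allVertices R
      v∈R with ∈.∈-++⁻ (vertices c) (↭.∈-resp-↭ (allVertices-↭ S↭cR) (IsPartition⇒covering P v))
      ... | inj₁ v∈c = ⊥-elim (∈ᵇ-false⇒∉ v∈ᵇc v∈c)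
      ... | inj₂ v∈R = v∈R
      d = proj₁ (extract v R)
      R′ = proj₂ (extract v R)
      v∈d = proj₁ (extract-spec v R v∈R)
      R↭dR′ = proj₂ (extract-spec v R v∈R)

  addEdge-partition : ∀ {S} → IsPartition S → ∀ u v → IsPartition (addEdge (u , v) S)
  addEdge-partition {S} P@(S↭ , nonEmpty) u v with addEdgeView P u v
  ... | within c R S↭cR _ _ eq rewrite eq with ↭.All-resp-↭ S↭cR nonEmpty
  ...   | c≠[] ∷ R≠[] = ↭-trans (↭-sym (allVertices-↭ S↭cR)) S↭ , c≠[] ∷ R≠[]
  addEdge-partition {S} P@(S↭ , nonEmpty) u v | joining c d R S↭cdR _ _ _ eq rewrite eq
    with ↭.All-resp-↭ S↭cdR nonEmpty
  ...   | c≠[] ∷ _ ∷ R≠[] =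
          ↭-trans (↭-reflexive (List.++-assoc (vertices c) (vertices d) (allVertices R)))
                  (↭-trans (↭-sym (allVertices-↭ S↭cdR)) S↭)
          , ℕ.<-≤-trans c≠[] (List.length-++-≤ˡ (vertices c)) ∷ R≠[]

  singleton : Fin n → Component n
  singleton x = component [ x ] 0

  components : List (Fin n × Fin n) → List (Component n)
  components [] = map singleton (allFin n)
  components (e ∷ es) = addEdge e (components es)

  components-partition : ∀ es → IsPartition (components es)
  components-partition [] = ↭-reflexive (allVertices-singletons (allFin n)) , singletons-nonEmpty (allFin n)
    where
      allVertices-singletons : ∀ xs → allVertices (map singleton xs) ≡ xs
      allVertices-singletons [] = refl
      allVertices-singletons (x ∷ xs) = cong (x ∷_) (allVertices-singletons xs)
      singletons-nonEmpty : ∀ xs → All NonEmpty (map singleton xs)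
      singletons-nonEmpty [] = []
      singletons-nonEmpty (x ∷ xs) = s≤s z≤n ∷ singletons-nonEmpty xs
  components-partition ((u , v) ∷ es) = addEdge-partition (components-partition es) u v

  -- The product formula

  componentWeight : List (Fin n) → Component n → ℕ
  componentWeight A c = weight (rank c) (length (vertices c)) (countIn A (vertices c))

  weightProduct : List (Fin n) → List (Component n) → ℕ
  weightProduct A S = product (map (componentWeight A) S)

  weightProduct-↭ : ∀ A {S S′} → S ↭ S′ → weightProduct A S ≡ weightProduct A S′
  weightProduct-↭ A p = ℕ.product-↭ (↭.map⁺ (componentWeight A) p)

  weightProduct-∷-∉ : ∀ {x} A R → x ∉ allVertices R → weightProduct (x ∷ A) R ≡ weightProduct A R
  weightProduct-∷-∉ A [] _ = refl
  weightProduct-∷-∉ A (c ∷ R) x∉ =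
    cong₂ _*_ (cong (weight (rank c) (length (vertices c))) (countIn-∷-∉ A (vertices c) (x∉ ∘ ∈.∈-++⁺ˡ)))
              (weightProduct-∷-∉ A R (x∉ ∘ ∈.∈-++⁺ʳ (vertices c)))

  weightProduct-singletons : ∀ A xs → weightProduct A (map singleton xs) ≡ 1
  weightProduct-singletons A [] = refl
  weightProduct-singletons A (x ∷ xs) with x ∈ᵇ A
  ... | true = trans (ℕ.+-identityʳ _) (weightProduct-singletons A xs)
  ... | false = trans (ℕ.+-identityʳ _) (weightProduct-singletons A xs)

  -- If x is already excluded then so is a vertex of c, and the weight on the right vanishes.
  weightProduct-choose : ∀ {x} A c R → Unique (allVertices (c ∷ R)) → x ∈ vertices c →
    (if x ∈ᵇ A then 0 else weightProduct (x ∷ A) (c ∷ R))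
      ≡ weight (rank c) (length (vertices c)) (suc (countIn A (vertices c))) * weightProduct A R
  weightProduct-choose {x} A c R u x∈c with x ∈ᵇ A in x∈ᵇA
  ... | false = cong₂ _*_
          (cong (weight (rank c) (length (vertices c)))
                (countIn-∷-∈ A (vertices c) (Unique-++⁻ˡ (vertices c) u) x∈c x∈ᵇA))
          (weightProduct-∷-∉ A R (Unique-++⇒disjoint (vertices c) u x∈c))
  ... | true with countIn A (vertices c) in count≡
  ...   | zero with () ← trans (sym x∈ᵇA) (countIn-≡0 A (vertices c) count≡ x∈c)
  ...   | suc _ = refl

  weightProduct-addEdge : ∀ {S} → IsPartition S → ∀ u v A →
    (if u ∈ᵇ A then 0 else weightProduct (u ∷ A) S) + (if v ∈ᵇ A then 0 else weightProduct (v ∷ A) S)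
      ≡ weightProduct A (addEdge (u , v) S)
  weightProduct-addEdge {S} P u v A with addEdgeView P u v
  ... | within c R S↭cR u∈c v∈c eq rewrite eq = begin
      guarded u S + guarded v S
    ≡⟨ cong₂ _+_ (reorder u) (reorder v) ⟩
      guarded u (c ∷ R) + guarded v (c ∷ R)
    ≡⟨ cong₂ _+_ (weightProduct-choose A c R uniq u∈c) (weightProduct-choose A c R uniq v∈c) ⟩
      w₁ * weightProduct A R + w₁ * weightProduct A R
    ≡⟨ ℕ.*-distribʳ-+ (weightProduct A R) w₁ w₁ ⟨
      (w₁ + w₁) * weightProduct A R
    ≡⟨ cong (_* weightProduct A R) (weight-close (rank c) (length (vertices c)) (countIn A (vertices c))) ⟩
      weightProduct A (closeCycle c ∷ R)
    ∎
    where
      open ≡-Reasoning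
      guarded : Fin n → List (Component n) → ℕ
      guarded x T = if x ∈ᵇ A then 0 else weightProduct (x ∷ A) T
      reorder : ∀ x → guarded x S ≡ guarded x (c ∷ R)
      reorder x = cong (if x ∈ᵇ A then 0 else_) (weightProduct-↭ (x ∷ A) S↭cR)
      uniq : Unique (allVertices (c ∷ R))
      uniq = Unique-resp-↭ (allVertices-↭ S↭cR) (IsPartition⇒Unique P)
      w₁ = weight (rank c) (length (vertices c)) (suc (countIn A (vertices c)))
  ... | joining c d R S↭cdR u∈c v∈d v∉c eq rewrite eq = begin
      guarded u S + guarded v S
    ≡⟨ cong₂ _+_ (reorder u) (reorder v) ⟩
      guarded u (c ∷ d ∷ R) + guarded v (c ∷ d ∷ R)
    ≡⟨ cong₂ _+_ (weightProduct-choose A c (d ∷ R) uniq u∈c) choose-v ⟩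
      wc₁ * (wd₀ * weightProduct A R) + wc₀ * (wd₁ * weightProduct A R)
    ≡⟨ cong₂ _+_ (ℕ.*-assoc wc₁ wd₀ _) (ℕ.*-assoc wc₀ wd₁ _) ⟨
      wc₁ * wd₀ * weightProduct A R + wc₀ * wd₁ * weightProduct A R
    ≡⟨ ℕ.*-distribʳ-+ (weightProduct A R) (wc₁ * wd₀) (wc₀ * wd₁) ⟨
      (wc₁ * wd₀ + wc₀ * wd₁) * weightProduct A R
    ≡⟨ cong (_* weightProduct A R) (weight-join (rank c) (rank d) (length (vertices c)) (length (vertices d))
                                                 (countIn A (vertices c)) (countIn A (vertices d))) ⟩
      weight (rank c + rank d) (length (vertices c) + length (vertices d))
             (countIn A (vertices c) + countIn A (vertices d)) * weightProduct A R
    ≡⟨ cong₂ (λ s k → weight (rank c + rank d) s k * weightProduct A R)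
             (List.length-++ (vertices c)) (countᵇ-++ (_∈ᵇ A) (vertices c) (vertices d)) ⟨
      weightProduct A (merge c d ∷ R)
    ∎
    where
      open ≡-Reasoning
      guarded : Fin n → List (Component n) → ℕ
      guarded x T = if x ∈ᵇ A then 0 else weightProduct (x ∷ A) T
      reorder : ∀ x → guarded x S ≡ guarded x (c ∷ d ∷ R)
      reorder x = cong (if x ∈ᵇ A then 0 else_) (weightProduct-↭ (x ∷ A) S↭cdR)
      uniq : Unique (allVertices (c ∷ d ∷ R))
      uniq = Unique-resp-↭ (allVertices-↭ S↭cdR) (IsPartition⇒Unique P)
      wc₀ = componentWeight A c
      wc₁ = weight (rank c) (length (vertices c)) (suc (countIn A (vertices c)))
      wd₀ = componentWeight A d
      wd₁ = weight (rank d) (length (vertices d)) (suc (countIn A (vertices d)))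
      choose-v : guarded v (c ∷ d ∷ R) ≡ wc₀ * (wd₁ * weightProduct A R)
      choose-v = begin
          guarded v (c ∷ d ∷ R)
        ≡⟨ cong (λ k → if v ∈ᵇ A then 0
                        else weight (rank c) (length (vertices c)) k * weightProduct (v ∷ A) (d ∷ R))
                (countIn-∷-∉ A (vertices c) v∉c) ⟩
          (if v ∈ᵇ A then 0 else wc₀ * weightProduct (v ∷ A) (d ∷ R))
        ≡⟨ guard-* (v ∈ᵇ A) wc₀ _ ⟩
          wc₀ * guarded v (d ∷ R)
        ≡⟨ cong (wc₀ *_) (weightProduct-choose A d R (Unique-++⁻ʳ (vertices c) uniq) v∈d) ⟩
          wc₀ * (wd₁ * weightProduct A R)
        ∎

  choices-components : ∀ es A → choices es A ≡ weightProduct A (components es)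
  choices-components [] A = sym (weightProduct-singletons A (allFin n))
  choices-components ((u , v) ∷ es) A
    rewrite choices-components es (u ∷ A) | choices-components es (v ∷ A)
    = weightProduct-addEdge (components-partition es) u v A

  SameComponent : List (Component n) → Fin n → Fin n → Set
  SameComponent S p q = ∃ λ c → c ∈ S × p ∈ vertices c × q ∈ vertices c

  sameComponent-sym : ∀ {S p q} → SameComponent S p q → SameComponent S q p
  sameComponent-sym (c , c∈ , p∈ , q∈) = c , c∈ , q∈ , p∈

  ∈-↭ : ∀ {S R : List (Component n)} {c d} → S ↭ c ∷ R → d ∈ c ∷ R → d ∈ S
  ∈-↭ S↭ = ↭.∈-resp-↭ (↭-sym S↭)

  component-unique : ∀ {S : List (Component n)} {c d x} → Unique (allVertices S) →
                     c ∈ S → d ∈ S → x ∈ vertices c → x ∈ vertices d → c ≡ d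
  component-unique {c ∷ S} uniq (here refl) (here refl) x∈c x∈d = refl
  component-unique {c ∷ S} uniq (here refl) (there d∈S) x∈c x∈d =
    ⊥-elim (Unique-++⇒disjoint (vertices c) uniq x∈c (∈-allVertices S d∈S x∈d))
  component-unique {c ∷ S} uniq (there c∈S) (here refl) x∈c x∈d =
    ⊥-elim (Unique-++⇒disjoint (vertices c) uniq x∈d (∈-allVertices S c∈S x∈c))
  component-unique {c ∷ S} uniq (there c∈S) (there d∈S) x∈c x∈d =
    component-unique (Unique-++⁻ʳ (vertices c) uniq) c∈S d∈S x∈c x∈d

  sameComponent-trans : ∀ {S p q r} → IsPartition S →
                        SameComponent S p q → SameComponent S q r → SameComponent S p r
  sameComponent-trans P (c , c∈ , p∈ , q∈) (d , d∈ , q∈′ , r∈)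
    with component-unique (IsPartition⇒Unique P) c∈ d∈ q∈ q∈′
  ... | refl = c , c∈ , p∈ , r∈

  sameComponent-refl : ∀ {S} → IsPartition S → ∀ p → SameComponent S p p
  sameComponent-refl {S} P p = let (p∈ , S↭) = extract-spec p S (IsPartition⇒covering P p) in
    proj₁ (extract p S) , ∈-↭ S↭ (here refl) , p∈ , p∈

  addEdge-sameComponent : ∀ {S} → IsPartition S → ∀ u v {p q} →
                          SameComponent S p q → SameComponent (addEdge (u , v) S) p q
  addEdge-sameComponent P u v (b , b∈ , p∈ , q∈) with addEdgeView P u v
  ... | within c R S↭ _ _ eq rewrite eq with ↭.∈-resp-↭ S↭ b∈
  ...   | here refl = _ , here refl , p∈ , q∈
  ...   | there b∈R = b , there b∈R , p∈ , q∈
  addEdge-sameComponent P u v (b , b∈ , p∈ , q∈) | joining c d R S↭ _ _ _ eq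
    rewrite eq with ↭.∈-resp-↭ S↭ b∈
  ...   | here refl = _ , here refl , ∈.∈-++⁺ˡ p∈ , ∈.∈-++⁺ˡ q∈
  ...   | there (here refl) = _ , here refl , ∈.∈-++⁺ʳ (vertices c) p∈ , ∈.∈-++⁺ʳ (vertices c) q∈
  ...   | there (there b∈R) = b , there b∈R , p∈ , q∈

  addEdge-joins : ∀ {S} → IsPartition S → ∀ u v → SameComponent (addEdge (u , v) S) u v
  addEdge-joins P u v with addEdgeView P u v
  ... | within c R _ u∈ v∈ eq rewrite eq = _ , here refl , u∈ , v∈
  ... | joining c d R _ u∈ v∈ _ eq rewrite eq = _ , here refl , ∈.∈-++⁺ˡ u∈ , ∈.∈-++⁺ʳ (vertices c) v∈

  Adj⇒sameComponent : ∀ es {p q} → Adj (mkGraph es) p q → SameComponent (components es) p q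
  Adj⇒sameComponent ((u , v) ∷ es) (inj₁ (here refl)) = addEdge-joins (components-partition es) u v
  Adj⇒sameComponent ((u , v) ∷ es) (inj₂ (here refl)) =
    sameComponent-sym (addEdge-joins (components-partition es) u v)
  Adj⇒sameComponent ((u , v) ∷ es) (inj₁ (there pq∈)) =
    addEdge-sameComponent (components-partition es) u v (Adj⇒sameComponent es (inj₁ pq∈))
  Adj⇒sameComponent ((u , v) ∷ es) (inj₂ (there qp∈)) =
    addEdge-sameComponent (components-partition es) u v (Adj⇒sameComponent es (inj₂ qp∈))

  Walk⇒sameComponent : ∀ es {p q} → Walk (mkGraph es) p q → SameComponent (components es) p q
  Walk⇒sameComponent es [] = sameComponent-refl (components-partition es) _
  Walk⇒sameComponent es (a ∷ w) =
    sameComponent-trans (components-partition es) (Adj⇒sameComponent es a) (Walk⇒sameComponent es w)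

  sameComponent⇒Walk : ∀ es {p q} → SameComponent (components es) p q → Walk (mkGraph es) p q
  sameComponent⇒Walk [] (c , c∈ , p∈ , q∈) with ∈.∈-map⁻ singleton c∈
  ... | x , _ , refl with p∈ | q∈
  ...   | here refl | here refl = []
  sameComponent⇒Walk ((u , v) ∷ es) (b , b∈ , p∈ , q∈) with addEdgeView (components-partition es) u v
  ... | within c R S↭ _ _ eq rewrite eq with b∈
  ...   | here refl = Walk-there (sameComponent⇒Walk es (c , ∈-↭ S↭ (here refl) , p∈ , q∈))
  ...   | there b∈R = Walk-there (sameComponent⇒Walk es (b , ∈-↭ S↭ (there b∈R) , p∈ , q∈))
  sameComponent⇒Walk ((u , v) ∷ es) (b , b∈ , p∈ , q∈) | joining c d R S↭ u∈c v∈d _ eq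
    rewrite eq = joined b∈ p∈ q∈
    where
      walkIn : ∀ {b p q} → b ∈ c ∷ d ∷ R → p ∈ vertices b → q ∈ vertices b → Walk (mkGraph ((u , v) ∷ es)) p q
      walkIn {b} b∈ p∈ q∈ = Walk-there (sameComponent⇒Walk es (b , ∈-↭ S↭ b∈ , p∈ , q∈))
      joined : ∀ {b p q} → b ∈ merge c d ∷ R → p ∈ vertices b → q ∈ vertices b → Walk (mkGraph ((u , v) ∷ es)) p q
      joined (there b∈R) p∈ q∈ = walkIn (there (there b∈R)) p∈ q∈
      joined (here refl) p∈ q∈ with ∈.∈-++⁻ (vertices c) p∈ | ∈.∈-++⁻ (vertices c) q∈
      ... | inj₁ p∈c | inj₁ q∈c = walkIn (here refl) p∈c q∈c
      ... | inj₂ p∈d | inj₂ q∈d = walkIn (there (here refl)) p∈d q∈d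
      ... | inj₁ p∈c | inj₂ q∈d = walkIn (here refl) p∈c u∈c ++ʷ (inj₁ (here refl) ∷ walkIn (there (here refl)) v∈d q∈d)
      ... | inj₂ p∈d | inj₁ q∈c = walkIn (there (here refl)) p∈d v∈d ++ʷ (inj₂ (here refl) ∷ walkIn (here refl) u∈c q∈c)

  totalRank : List (Component n) → ℕ
  totalRank S = sum (map rank S)

  totalRank-↭ : ∀ {S S′} → S ↭ S′ → totalRank S ≡ totalRank S′
  totalRank-↭ p = ℕ.sum-↭ (↭.map⁺ rank p)

  totalRank-singletons : ∀ xs → totalRank (map singleton xs) ≡ 0
  totalRank-singletons [] = refl
  totalRank-singletons (_ ∷ xs) = totalRank-singletons xs

  totalRank-closeCycle : ∀ {S} c R → S ↭ c ∷ R → totalRank (closeCycle c ∷ R) ≡ suc (totalRank S)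
  totalRank-closeCycle c R S↭ = cong suc (sym (totalRank-↭ S↭))

  totalRank-merge : ∀ {S} c d R → S ↭ c ∷ d ∷ R → totalRank (merge c d ∷ R) ≡ totalRank S
  totalRank-merge c d R S↭ = trans (ℕ.+-assoc (rank c) (rank d) (totalRank R)) (sym (totalRank-↭ S↭))

  rank-positive⇒cycle : ∀ es → Simple (mkGraph es) → 1 ≤ totalRank (components es) →
                        ∃ λ vs → IsCycle (mkGraph es) vs
  rank-positive⇒cycle [] _ 1≤ with () ← subst (1 ≤_) (totalRank-singletons (allFin n)) 1≤
  rank-positive⇒cycle ((u , v) ∷ es) simple 1≤ with addEdgeView (components-partition es) u v
  ... | within c R S↭ u∈c v∈c _ =
        let (vs , cycle , _) = closeWalk simple (sameComponent⇒Walk es (c , ∈-↭ S↭ (here refl) , u∈c , v∈c)) in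
        vs , cycle
  ... | joining c d R S↭ _ _ _ eq =
        let (vs , cycle) = rank-positive⇒cycle es (Simple-tail simple)
                             (subst (1 ≤_) (trans (cong totalRank eq) (totalRank-merge c d R S↭)) 1≤) in
        vs , IsCycle-there cycle

  rank≥2⇒distinctCycles : ∀ es → Simple (mkGraph es) → 2 ≤ totalRank (components es) →
    ∃ λ vs → ∃ λ ws → IsCycle (mkGraph es) vs × IsCycle (mkGraph es) ws ×
      ∃ λ a → ∃ λ b → CycEdge vs a b × ¬ CycEdge ws a b
  rank≥2⇒distinctCycles [] _ 2≤ with () ← subst (2 ≤_) (totalRank-singletons (allFin n)) 2≤
  rank≥2⇒distinctCycles ((u , v) ∷ es) simple 2≤ with addEdgeView (components-partition es) u v
  ... | within c R S↭ u∈c v∈c eq =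
        let (vs , vs-cycle , vu∈vs) =
              closeWalk simple (sameComponent⇒Walk es (c , ∈-↭ S↭ (here refl) , u∈c , v∈c))
            (ws , ws-cycle@(_ , _ , ws-adj)) = rank-positive⇒cycle es (Simple-tail simple)
              (ℕ.≤-pred (subst (2 ≤_) (trans (cong totalRank eq) (totalRank-closeCycle c R S↭)) 2≤))
            uv∉ws : ¬ CycEdge ws v u
            uv∉ws = λ { (inj₁ vu∈) → Simple⇒¬Adj simple (Adj-sym (All.lookup ws-adj vu∈))
                      ; (inj₂ uv∈) → Simple⇒¬Adj simple (All.lookup ws-adj uv∈) }
        in vs , ws , vs-cycle , IsCycle-there ws-cycle , v , u , inj₁ vu∈vs , uv∉ws
  ... | joining c d R S↭ _ _ _ eq =
        let (vs , ws , vs-cycle , ws-cycle , rest) = rank≥2⇒distinctCycles es (Simple-tail simple)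
              (subst (2 ≤_) (trans (cong totalRank eq) (totalRank-merge c d R S↭)) 2≤) in
        vs , ws , IsCycle-there vs-cycle , IsCycle-there ws-cycle , rest

  sameComponent⇒∈ᵇ-≡ : ∀ {S c p q} → IsPartition S → c ∈ S → SameComponent S p q →
                        (p ∈ᵇ vertices c) ≡ (q ∈ᵇ vertices c)
  sameComponent⇒∈ᵇ-≡ {c = c} {p} {q} P c∈ (d , d∈ , p∈d , q∈d)
    with p ∈ᵇ vertices c in p∈ᵇc | q ∈ᵇ vertices c in q∈ᵇc
  ... | true | true = refl
  ... | false | false = refl
  ... | true | false with component-unique (IsPartition⇒Unique P) c∈ d∈ (∈ᵇ⇒∈ (vertices c) p∈ᵇc) p∈d
  ...   | refl = ⊥-elim (∈ᵇ-false⇒∉ q∈ᵇc q∈d)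
  sameComponent⇒∈ᵇ-≡ {c = c} P c∈ (d , d∈ , p∈d , q∈d) | false | true
    with component-unique (IsPartition⇒Unique P) c∈ d∈ (∈ᵇ⇒∈ (vertices c) q∈ᵇc) q∈d
  ...   | refl = ⊥-elim (∈ᵇ-false⇒∉ p∈ᵇc p∈d)

  joining-acyclic : ∀ {es u v} c → c ∈ components es → u ∈ vertices c → v ∉ vertices c →
                    Acyclic (mkGraph es) → Acyclic (mkGraph ((u , v) ∷ es))
  joining-acyclic c c∈ u∈c v∉c acyclic [] (() , _)
  joining-acyclic {es} {u} {v} c c∈ u∈c v∉c acyclic (x ∷ xs) (3≤ , uniq , adj) =
    byDirection (member? pairDec (u , v) (cycPairs (x ∷ xs))) (member? pairDec (v , u) (cycPairs (x ∷ xs)))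
    where
      pairDec = ≡-dec Fin._≟_ Fin._≟_
      inC : Fin n → Bool
      inC y = y ∈ᵇ vertices c
      preserved : ∀ {p q} → Adj (mkGraph es) p q → inC p ≡ inC q
      preserved pq-adj = sameComponent⇒∈ᵇ-≡ (components-partition es) c∈ (Adj⇒sameComponent es pq-adj)
      byDirection : Dec ((u , v) ∈ cycPairs (x ∷ xs)) → Dec ((v , u) ∈ cycPairs (x ∷ xs)) → ⊥
      byDirection (no uv∉) (no vu∉) =
        acyclic (x ∷ xs) (3≤ , uniq , All.tabulate λ pq∈ → oldEdge pq∈ (Adj-∷⁻ (All.lookup adj pq∈)))
        where
          oldEdge : ∀ {p q} → (p , q) ∈ cycPairs (x ∷ xs) →
                    (p , q) ≡ (u , v) ⊎ (p , q) ≡ (v , u) ⊎ Adj (mkGraph es) p q → Adj (mkGraph es) p q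
          oldEdge pq∈ (inj₁ refl) = ⊥-elim (uv∉ pq∈)
          oldEdge pq∈ (inj₂ (inj₁ refl)) = ⊥-elim (vu∉ pq∈)
          oldEdge pq∈ (inj₂ (inj₂ pq-adj)) = pq-adj
      byDirection (yes uv∈) (yes vu∈) = cycPairs-antisym (x ∷ xs) 3≤ uniq uv∈ vu∈
      byDirection (yes uv∈) (no vu∉) =
        cycle-noCrossing inC preserved (∈⇒∈ᵇ u∈c) (∉⇒∈ᵇ-false v∉c) x xs adj vu∉ uv∈
      byDirection (no uv∉) (yes vu∈) =
        cycle-noCrossing (not ∘ inC) (cong not ∘ preserved) (cong not (∉⇒∈ᵇ-false v∉c)) (cong not (∈⇒∈ᵇ u∈c))
                         x xs (All.map Adj-flip adj) uv∉ vu∈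

  rank-zero⇒acyclic : ∀ es → Simple (mkGraph es) → totalRank (components es) ≡ 0 → Acyclic (mkGraph es)
  rank-zero⇒acyclic [] _ _ (x ∷ []) (s≤s () , _)
  rank-zero⇒acyclic [] _ _ (x ∷ y ∷ _) (_ , _ , (inj₁ () ∷ _))
  rank-zero⇒acyclic [] _ _ (x ∷ y ∷ _) (_ , _ , (inj₂ () ∷ _))
  rank-zero⇒acyclic ((u , v) ∷ es) simple rank≡0 with addEdgeView (components-partition es) u v
  ... | within c R S↭ _ _ eq with () ← trans (sym (trans (cong totalRank eq) (totalRank-closeCycle c R S↭))) rank≡0
  ... | joining c d R S↭ u∈c _ v∉c eq =
        joining-acyclic c (∈-↭ S↭ (here refl)) u∈c v∉c
          (rank-zero⇒acyclic es (Simple-tail simple)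
            (trans (sym (trans (cong totalRank eq) (totalRank-merge c d R S↭))) rank≡0))

  connected⇒singleComponent : ∀ {S} → IsPartition S → (∀ x y → SameComponent S x y) → Fin n →
                              ∃ λ c → S ↭ [ c ] × length (vertices c) ≡ n
  connected⇒singleComponent {S} P@(S↭ , nonEmpty) same x = c , S↭[c] , |c|≡n
    where
      c = proj₁ (extract x S)
      R = proj₂ (extract x S)
      x∈c = proj₁ (extract-spec x S (IsPartition⇒covering P x))
      S↭cR = proj₂ (extract-spec x S (IsPartition⇒covering P x))
      everything∈c : ∀ y → y ∈ vertices c
      everything∈c y with same x y
      ... | d , d∈ , x∈d , y∈d
        with component-unique (IsPartition⇒Unique P) (∈-↭ S↭cR (here refl)) d∈ x∈c x∈d
      ...   | refl = y∈d
      R≡[] : ∀ R → Unique (allVertices (c ∷ R)) → All NonEmpty R → R ≡ []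
      R≡[] [] _ _ = refl
      R≡[] (component [] _ ∷ _) _ (() ∷ _)
      R≡[] (component (y ∷ _) _ ∷ _) uniq _ =
        ⊥-elim (Unique-++⇒disjoint (vertices c) uniq (everything∈c y) (here refl))
      S↭[c] : S ↭ [ c ]
      S↭[c] = subst (λ R → S ↭ c ∷ R)
                    (R≡[] R (Unique-resp-↭ (allVertices-↭ S↭cR) (IsPartition⇒Unique P))
                            (All.tail (↭.All-resp-↭ S↭cR nonEmpty)))
                    S↭cR
      |c|≡n : length (vertices c) ≡ n
      |c|≡n = trans (sym (cong length (List.++-identityʳ (vertices c))))
                    (trans (↭.↭-length (↭-trans (↭-sym (allVertices-↭ S↭[c])) S↭)) (List.length-tabulate id))

  choices-connected : ∀ es → Connected (mkGraph es) → choices es [] ≡ weight (totalRank (components es)) n 0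
  choices-connected es (1≤n , walk) = begin
      choices es []
    ≡⟨ choices-components es [] ⟩
      weightProduct [] (components es)
    ≡⟨ weightProduct-↭ [] S↭[c] ⟩
      weight (rank c) (length (vertices c)) (countIn [] (vertices c)) * 1
    ≡⟨ ℕ.*-identityʳ _ ⟩
      weight (rank c) (length (vertices c)) (countIn [] (vertices c))
    ≡⟨ cong₂ (weight (rank c)) |c|≡n (countIn-[] (vertices c)) ⟩
      weight (rank c) n 0
    ≡⟨ cong (λ k → weight k n 0) (trans (totalRank-↭ S↭[c]) (ℕ.+-identityʳ (rank c))) ⟨
      weight (totalRank (components es)) n 0
    ∎
    where
      open ≡-Reasoning
      single = connected⇒singleComponent (components-partition es)
                 (λ x y → Walk⇒sameComponent es (walk x y)) (Fin.fromℕ< 1≤n)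
      c = proj₁ single
      S↭[c] = proj₁ (proj₂ single)
      |c|≡n = proj₂ (proj₂ single)

  acyclic⇒rank≡0 : ∀ es → Simple (mkGraph es) → Acyclic (mkGraph es) → totalRank (components es) ≡ 0
  acyclic⇒rank≡0 es simple acyclic with totalRank (components es) in rank≡
  ... | zero = refl
  ... | suc _ = let (vs , cycle) = rank-positive⇒cycle es simple (subst (1 ≤_) (sym rank≡) (s≤s z≤n)) in
                ⊥-elim (acyclic vs cycle)

  unicyclic⇒rank≡1 : ∀ es → Simple (mkGraph es) → ∀ vs → IsCycle (mkGraph es) vs →
                     (∀ ws → IsCycle (mkGraph es) ws → SameCycle vs ws) → totalRank (components es) ≡ 1
  unicyclic⇒rank≡1 es simple vs cycle unique with totalRank (components es) in rank≡
  ... | zero = ⊥-elim (rank-zero⇒acyclic es simple rank≡ vs cycle)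
  ... | suc zero = refl
  ... | suc (suc _) =
        let (ws₁ , ws₂ , cycle₁ , cycle₂ , a , b , ab∈ws₁ , ab∉ws₂) =
              rank≥2⇒distinctCycles es simple (subst (2 ≤_) (sym rank≡) (s≤s (s≤s z≤n))) in
        ⊥-elim (ab∉ws₂ (Equivalence.to (unique ws₂ cycle₂ a b)
                         (Equivalence.from (unique ws₁ cycle₁ a b) ab∈ws₁)))

lemma2p3 : (∀ (n : ℕ) (T : Graph n) → Simple T → IsTree T →
             matchings (subdivision T) (length (edges T)) ≡ n)
           × (∀ (n : ℕ) (U : Graph n) → Simple U → Unicyclic U →
             matchings (subdivision U) (length (edges U)) ≡ 2)
lemma2p3 = tree , unicyclic
  where
    tree : ∀ n (T : Graph n) → Simple T → IsTree T → matchings (subdivision T) (length (edges T)) ≡ n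
    tree n T simple (connected , acyclic) = begin
        matchings (subdivision T) (length (edges T))
      ≡⟨ matchings-subdivision T ⟩
        choices (edges T) []
      ≡⟨ choices-connected (edges T) connected ⟩
        weight (totalRank (components (edges T))) n 0
      ≡⟨ cong (λ k → weight k n 0) (acyclic⇒rank≡0 (edges T) simple acyclic) ⟩
        n
      ∎
      where open ≡-Reasoning
            open Components n
    unicyclic : ∀ n (U : Graph n) → Simple U → Unicyclic U → matchings (subdivision U) (length (edges U)) ≡ 2
    unicyclic n U simple (connected , vs , cycle , unique) = begin
        matchings (subdivision U) (length (edges U))
      ≡⟨ matchings-subdivision U ⟩
        choices (edges U) []
      ≡⟨ choices-connected (edges U) connected ⟩
        weight (totalRank (components (edges U))) n 0
      ≡⟨ cong (λ k → weight k n 0) (unicyclic⇒rank≡1 (edges U) simple vs cycle unique) ⟩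
        2
      ∎
      where open ≡-Reasoning
            open Components n
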